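{- Let $k\ge 1$ and $n$ be integers with $n\ge k+3\ge 4$, and let $\overline{C_n}$ be the complement of the cycle $C_n$ of order $n$. Then $$\gamma_{\times k,t}^{r}(\overline{C_n})=\begin{cases} n & \text{if } n\le 2k+2,\\ k+2 & \text{if } 2k+3\le n\le 3k+2,\\ k+1 & \text{if } n\ge 3k+3.\end{cases}$$
   Context: All graphs are finite and simple; $N(x)$ denotes the open neighborhood of $x$. For an integer $k\ge 1$, a set $S\subseteq V(G)$ is a $k$-tuple total dominating set of $G$ if $|N(x)\cap S|\ge k$ for every $x\in V(G)$. It is a $k$-tuple total restrained dominating set (kTRDS) if moreover every vertex $x\in V(G)\setminus S$ is adjacent to at least $k$ vertices of $V(G)\setminus S$. For a graph with minimum degree at least $k$, $\gamma_{\times k,t}^{r}(G)$ denotes the minimum cardinality of a kTRDS of $G$. $\overline{H}$ denotes the complement of a graph $H$. -}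

module Defs where

open import Data.Nat using (ℕ; zero; suc; _+_; _≤_; _≥_; _%_)
open import Data.Nat.Properties using (_≟_)
open import Data.Bool using (Bool; true; false; not; _∧_; _∨_)
open import Data.Fin using (Fin; toℕ)
open import Data.Fin.Subset using (Subset; _∩_; ∣_∣; ∁)
open import Data.Vec using (tabulate; lookup)
open import Relation.Binary.PropositionalEquality using (_≡_)
open import Data.Product using (Σ; _×_)
open import Relation.Nullary.Decidable using (⌊_⌋)

-- A (finite simple) graph on the vertex set Fin n, given by a Boolean adjacency
-- relation (assumed symmetric and irreflexive where relevant).
Graph : ℕ → Set
Graph n = Fin n → Fin n → Bool

-- The cycle C_n on vertices 0,…,n-1: i ~ j iff |i - j| = 1 or {i,j} = {0,n-1}.
-- (For n ≥ 3 this is the simple cycle 0-1-…-(n-1)-0 of order n.)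
cycleAdj : (n : ℕ) → Graph n
cycleAdj n i j =
  ⌊ toℕ j ≟ suc (toℕ i) ⌋ ∨ ⌊ toℕ i ≟ suc (toℕ j) ⌋ ∨
  (⌊ toℕ i ≟ 0 ⌋ ∧ ⌊ suc (toℕ j) ≟ n ⌋) ∨ (⌊ toℕ j ≟ 0 ⌋ ∧ ⌊ suc (toℕ i) ≟ n ⌋)

complement : {n : ℕ} → Graph n → Graph n
complement G i j = not ⌊ toℕ i ≟ toℕ j ⌋ ∧ not (G i j)

coCycle : (n : ℕ) → Graph n
coCycle n = complement (cycleAdj n)

N : {n : ℕ} → Graph n → Fin n → Subset n
N G x = tabulate (G x)

IsKTRDS : {n : ℕ} → ℕ → Graph n → Subset n → Set
IsKTRDS {n} k G S =
  ((x : Fin n) → ∣ N G x ∩ S ∣ ≥ k) ×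
  ((x : Fin n) → lookup S x ≡ false → ∣ N G x ∩ ∁ S ∣ ≥ k)

IsKTRDNumber : {n : ℕ} → ℕ → Graph n → ℕ → Set
IsKTRDNumber k G m =
  Σ _ (λ S → IsKTRDS k G S × ∣ S ∣ ≡ m) × (∀ S → IsKTRDS k G S → m ≤ ∣ S ∣)

-- In the complement of G a vertex x is adjacent to everything outside its closed G-neighbourhood
-- N[x], so S is a kTRDS of the complement iff k + |N[x] ∩ S| ≤ |S| for every x and
-- k + |N[x] ∖ S| ≤ |V ∖ S| for every x ∉ S. In C_n each N[x] has exactly three vertices.
-- A vertex outside S therefore forces n ≥ 2k + 3, so for n ≤ 2k + 2 only V itself works.
-- If |S| = k + 1 then every N[x] meets S at most once, and counting the pairs (x, y ∈ N[x] ∩ S)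
-- in two ways gives 3(k + 1) ≤ n; this is the lower bound k + 2 for n ≤ 3k + 2.
-- The bounds are attained by V, by the even positions 0, 2, …, 2k + 2, and by the multiples
-- 0, 3, …, 3k of three.

module Submission where

open import Defs
open import Data.Nat using (ℕ; zero; suc; _+_; _*_; _∸_; _≤_; _<_; _≥_; _≤?_; z≤n; s≤s; s≤s⁻¹; NonZero)
open import Data.Nat.Properties
open import Data.Nat.Divisibility using (_∣_; _∣?_; _∣0; n∣n; n∣m*n; ∣m+n∣m⇒∣n; ∣m∣n⇒∣m+n; ∣⇒≤; >⇒∤)
open import Data.Bool using (Bool; true; false; not; _∧_; _∨_; T; if_then_else_)
open import Data.Bool.Properties using (∧-identityʳ; T-∨; T-∧; T-≡; ∨-comm)
open import Data.Fin using (Fin; toℕ; fromℕ; fromℕ<; inject₁; lower₁)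
  renaming (zero to fzero; suc to fsuc)
open import Data.Fin.Properties using (toℕ-fromℕ; toℕ-inject₁; toℕ-lower₁; toℕ-injective; toℕ<n)
open import Data.Fin.Subset using (Subset; _∩_; ∁; ∣_∣; _∈_; _⊆_; ⁅_⁆; ⊤)
open import Data.Fin.Subset.Properties
open import Data.List using (List; []; _∷_; length)
open import Data.List.Membership.Propositional using () renaming (_∈_ to _∈ₗ_)
open import Data.List.Relation.Unary.Any using (here; there)
open import Data.List.Relation.Unary.All as All using (All; []; _∷_)
open import Data.List.Relation.Unary.Unique.Propositional using (Unique; []; _∷_)
open import Data.Vec using ([]; _∷_; tabulate; lookup)
open import Data.Vec.Properties
  using (lookup-replicate; tabulate-∘; tabulate-cong; lookup∘tabulate; lookup-zipWith; lookup⇒[]=; []=⇒lookup)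
open import Data.Product using (_×_; _,_; proj₁; proj₂)
open import Data.Sum as Sum using (_⊎_; inj₁; inj₂)
open import Function using (_∘_; _∘′_; id; flip; case_of_)
open import Function.Bundles using (_⇔_; mk⇔; Equivalence)
open import Function.Construct.Composition using (_⇔-∘_)
open import Data.Sum.Function.Propositional using (_⊎-⇔_)
open import Data.Product.Function.NonDependent.Propositional using (_×-⇔_)
open import Relation.Binary.PropositionalEquality
open import Relation.Nullary using (¬_; Dec; does; yes; no; contradiction)
open import Relation.Nullary.Decidable using (⌊_⌋; _×-dec_; toWitness; fromWitness; does-⇔)
open import Relation.Unary using (Pred; Decidable)
open import Level using (0ℓ)
open import Data.Nat.Tactic.RingSolver using (solve-∀)
open import Algebra.Properties.Semiring.Sum +-*-semiring using (sum; ∑-comm; sum-cong-≗; *-distribˡ-sum)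

private variable
  n k : ℕ

-- Cardinalities of subsets

∣p∩q∣+∣p∩∁q∣≡∣p∣ : ∀ (p q : Subset n) → ∣ p ∩ q ∣ + ∣ p ∩ ∁ q ∣ ≡ ∣ p ∣
∣p∩q∣+∣p∩∁q∣≡∣p∣ []          []          = refl
∣p∩q∣+∣p∩∁q∣≡∣p∣ (true  ∷ p) (true  ∷ q) = cong suc (∣p∩q∣+∣p∩∁q∣≡∣p∣ p q)
∣p∩q∣+∣p∩∁q∣≡∣p∣ (true  ∷ p) (false ∷ q) = trans (+-suc _ _) (cong suc (∣p∩q∣+∣p∩∁q∣≡∣p∣ p q))
∣p∩q∣+∣p∩∁q∣≡∣p∣ (false ∷ p) (b     ∷ q) = ∣p∩q∣+∣p∩∁q∣≡∣p∣ p q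

∣p∣+∣∁p∣≡n : ∀ (p : Subset n) → ∣ p ∣ + ∣ ∁ p ∣ ≡ n
∣p∣+∣∁p∣≡n {n} p = trans (cong (∣ p ∣ +_) (∣∁p∣≡n∸∣p∣ p)) (m+[n∸m]≡n (∣p∣≤n p))

length≤∣p∣ : {p : Subset n} {xs : List (Fin n)} → Unique xs → All (_∈ p) xs → length xs ≤ ∣ p ∣
length≤∣p∣ {xs = []} _ _ = z≤n
length≤∣p∣ {p = p} {x ∷ xs} (x∉xs ∷ xs-unique) (x∈p ∷ xs⊆p) = begin
  1 + length xs                   ≤⟨ +-mono-≤ x∈p∩⁅x⁆ (length≤∣p∣ xs-unique xs⊆p-x) ⟩
  ∣ p ∩ ⁅ x ⁆ ∣ + ∣ p ∩ ∁ ⁅ x ⁆ ∣ ≡⟨ ∣p∩q∣+∣p∩∁q∣≡∣p∣ p ⁅ x ⁆ ⟩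
  ∣ p ∣                           ∎
  where
  open ≤-Reasoning
  x∈p∩⁅x⁆ : 1 ≤ ∣ p ∩ ⁅ x ⁆ ∣
  x∈p∩⁅x⁆ = ≤-trans (s≤s z≤n) (x∈p⇒∣p-x∣<∣p∣ (x∈p∩q⁺ (x∈p , x∈⁅x⁆ x)))
  xs⊆p-x : All (_∈ p ∩ ∁ ⁅ x ⁆) xs
  xs⊆p-x = All.zipWith (λ (x≢y , y∈p) → x∈p∩q⁺ (y∈p , x∉p⇒x∈∁p (x≢y⇒x∉⁅y⁆ (x≢y ∘′ sym))))
             (x∉xs , xs⊆p)

∣p∣≤length : {p : Subset n} (xs : List (Fin n)) → (∀ {i} → i ∈ p → i ∈ₗ xs) → ∣ p ∣ ≤ length xs
∣p∣≤length {n} {p} [] p⊆[] =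
  ≤-reflexive (trans (cong ∣_∣ (Empty-unique λ (i , i∈p) → case p⊆[] i∈p of λ ())) (∣⊥∣≡0 n))
∣p∣≤length {p = p} (x ∷ xs) p⊆x∷xs = begin
  ∣ p ∣                           ≡⟨ ∣p∩q∣+∣p∩∁q∣≡∣p∣ p ⁅ x ⁆ ⟨
  ∣ p ∩ ⁅ x ⁆ ∣ + ∣ p ∩ ∁ ⁅ x ⁆ ∣ ≤⟨ +-mono-≤ ∣p∩⁅x⁆∣≤1 (∣p∣≤length xs p-x⊆xs) ⟩
  1 + length xs                   ∎
  where
  open ≤-Reasoning
  ∣p∩⁅x⁆∣≤1 : ∣ p ∩ ⁅ x ⁆ ∣ ≤ 1
  ∣p∩⁅x⁆∣≤1 = ≤-trans (∣p∩q∣≤∣q∣ p ⁅ x ⁆) (≤-reflexive (∣⁅x⁆∣≡1 x))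
  p-x⊆xs : ∀ {i} → i ∈ p ∩ ∁ ⁅ x ⁆ → i ∈ₗ xs
  p-x⊆xs i∈ with x∈p∩q⁻ p _ i∈
  ... | i∈p , i∉⁅x⁆ with p⊆x∷xs i∈p
  ...   | here refl  = contradiction (x∈⁅x⁆ x) (x∈∁p⇒x∉p i∉⁅x⁆)
  ...   | there i∈xs = i∈xs

∈-tabulate⇔ : {f : Fin n → Bool} {i : Fin n} → i ∈ tabulate f ⇔ T (f i)
∈-tabulate⇔ {f = f} {i} = mk⇔
  (λ i∈ → Equivalence.from T-≡ (trans (sym (lookup∘tabulate f i)) ([]=⇒lookup i∈)))
  (λ fi → lookup⇒[]= i _ (trans (lookup∘tabulate f i) (Equivalence.to T-≡ fi)))

∑-mono-≤ : {f g : Fin n → ℕ} → (∀ i → f i ≤ g i) → sum f ≤ sum g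
∑-mono-≤ {zero}  f≤g = z≤n
∑-mono-≤ {suc n} f≤g = +-mono-≤ (f≤g fzero) (∑-mono-≤ {n} (f≤g ∘ fsuc))

∑-const : (c : ℕ) → sum {n} (λ _ → c) ≡ n * c
∑-const {zero}  c = refl
∑-const {suc n} c = cong (c +_) (∑-const {n} c)

𝟙 : Bool → ℕ
𝟙 b = if b then 1 else 0

∣p∣≡∑𝟙 : (p : Subset n) → ∣ p ∣ ≡ sum (λ i → 𝟙 (lookup p i))
∣p∣≡∑𝟙 []          = refl
∣p∣≡∑𝟙 (true  ∷ p) = cong suc (∣p∣≡∑𝟙 p)
∣p∣≡∑𝟙 (false ∷ p) = ∣p∣≡∑𝟙 p

double-counting : {R : Fin n → Fin n → Bool} {S : Subset n} {d c : ℕ} →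
  (∀ x y → R x y ≡ R y x) → (∀ y → d ≤ ∣ tabulate (R y) ∣) →
  (∀ x → ∣ tabulate (R x) ∩ S ∣ ≤ c) → d * ∣ S ∣ ≤ n * c
double-counting {n} {R} {S} {d} {c} R-sym d≤∣Ry∣ ∣Rx∩S∣≤c = begin
  d * ∣ S ∣                                ≡⟨ cong (d *_) (∣p∣≡∑𝟙 S) ⟩
  d * sum (λ y → 𝟙 (s y))                  ≡⟨ *-distribˡ-sum d (λ y → 𝟙 (s y)) ⟩
  sum (λ y → d * 𝟙 (s y))                  ≤⟨ ∑-mono-≤ column ⟩
  sum (λ y → sum (λ x → 𝟙 (R x y ∧ s y)))  ≡⟨ ∑-comm (λ x y → 𝟙 (R x y ∧ s y)) ⟨
  sum (λ x → sum (λ y → 𝟙 (R x y ∧ s y)))  ≡⟨ sum-cong-≗ (sym ∘ row) ⟩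
  sum (λ x → ∣ tabulate (R x) ∩ S ∣)        ≤⟨ ∑-mono-≤ ∣Rx∩S∣≤c ⟩
  sum {n} (λ _ → c)                         ≡⟨ ∑-const {n} c ⟩
  n * c                                     ∎
  where
  open ≤-Reasoning
  s = lookup S
  row : ∀ x → ∣ tabulate (R x) ∩ S ∣ ≡ sum (λ y → 𝟙 (R x y ∧ s y))
  row x = trans (∣p∣≡∑𝟙 (tabulate (R x) ∩ S)) (sum-cong-≗ λ y → cong 𝟙
    (trans (lookup-zipWith _∧_ y (tabulate (R x)) S) (cong (_∧ s y) (lookup∘tabulate (R x) y))))
  column : ∀ y → d * 𝟙 (s y) ≤ sum (λ x → 𝟙 (R x y ∧ s y))
  column y with s y
  ... | false = ≤-trans (≤-reflexive (*-zeroʳ d)) z≤n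
  ... | true  = begin
    d * 1                                       ≡⟨ *-identityʳ d ⟩
    d                                           ≤⟨ d≤∣Ry∣ y ⟩
    ∣ tabulate (R y) ∣                           ≡⟨ ∣p∣≡∑𝟙 (tabulate (R y)) ⟩
    sum (λ x → 𝟙 (lookup (tabulate (R y)) x))   ≡⟨ sum-cong-≗ (cong 𝟙 ∘ Ryx≡Rxy∧true) ⟩
    sum (λ x → 𝟙 (R x y ∧ true))                ∎
    where
    Ryx≡Rxy∧true : ∀ x → lookup (tabulate (R y)) x ≡ R x y ∧ true
    Ryx≡Rxy∧true x = trans (lookup∘tabulate (R y) x) (trans (R-sym y x) (sym (∧-identityʳ _)))

⟦_⟧ : {P : Pred ℕ 0ℓ} → Decidable P → Subset n
⟦ P? ⟧ = tabulate (λ i → does (P? (toℕ i)))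

∈⟦⟧⇔ : {P : Pred ℕ 0ℓ} {P? : Decidable P} {i : Fin n} → i ∈ ⟦ P? ⟧ ⇔ P (toℕ i)
∈⟦⟧⇔ {P? = P?} {i} with P? (toℕ i) | ∈-tabulate⇔ {f = λ i → does (P? (toℕ i))} {i}
... | yes Pi | i∈⇔ = mk⇔ (λ _ → Pi) (λ _ → Equivalence.from i∈⇔ _)
... | no ¬Pi | i∈⇔ = mk⇔ (λ i∈ → case Equivalence.to i∈⇔ i∈ of λ ()) (λ Pi → contradiction Pi ¬Pi)

∉⟦⟧ : {P : Pred ℕ 0ℓ} {P? : Decidable P} {x : Fin n} → lookup ⟦ P? ⟧ x ≡ false → ¬ P (toℕ x)
∉⟦⟧ {P? = P?} {x} x∉ Px =
  contradiction (trans (sym x∉) ([]=⇒lookup (Equivalence.from (∈⟦⟧⇔ {P? = P?}) Px))) λ ()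

⟦⟧-cong : {P Q : Pred ℕ 0ℓ} (P? : Decidable P) (Q? : Decidable Q) →
  (∀ v → v < n → P v ⇔ Q v) → ⟦ P? ⟧ ≡ ⟦_⟧ {n} Q?
⟦⟧-cong P? Q? P⇔Q = tabulate-cong λ i → does-⇔ (P⇔Q (toℕ i) (toℕ<n i)) (P? (toℕ i)) (Q? (toℕ i))

∣⟦⟧∣-+ : {P : Pred ℕ 0ℓ} (P? : Decidable P) (a b : ℕ) →
  ∣ ⟦_⟧ {a + b} P? ∣ ≡ ∣ ⟦_⟧ {a} P? ∣ + ∣ ⟦_⟧ {b} (λ v → P? (a + v)) ∣
∣⟦⟧∣-+ P? zero    b = refl
∣⟦⟧∣-+ P? (suc a) b with does (P? 0)
... | true  = cong suc (∣⟦⟧∣-+ (P? ∘ suc) a b)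
... | false = ∣⟦⟧∣-+ (P? ∘ suc) a b

∣⟦≡0⟧∣ : ∀ b → ∣ ⟦_⟧ {suc b} (_≟ 0) ∣ ≡ 1
∣⟦≡0⟧∣ b = ≤-antisym (∣p∣≤length {suc b} (fzero ∷ []) only0) (length≤∣p∣ ([] ∷ []) (0∈ ∷ []))
  where
  0∈ : fzero ∈ ⟦_⟧ {suc b} (_≟ 0)
  0∈ = Equivalence.from (∈⟦⟧⇔ {P? = _≟ 0}) refl
  only0 : ∀ {i} → i ∈ ⟦ (_≟ 0) ⟧ → i ∈ₗ fzero ∷ []
  only0 i∈ = here (toℕ-injective (Equivalence.to (∈⟦⟧⇔ {P? = _≟ 0}) i∈))

Spaced : ℕ → ℕ → Pred ℕ 0ℓ
Spaced g m v = g ∣ v × v ≤ m * g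

spaced? : ∀ g m → Decidable (Spaced g m)
spaced? g m v = g ∣? v ×-dec v ≤? m * g

multiples-apart : ∀ {g v} d → g ∣ v → g ∣ suc d + v → g ≤ suc d
multiples-apart {g} {v} d g∣v g∣d+v = ∣⇒≤ (∣m+n∣m⇒∣n (subst (g ∣_) (+-comm (suc d) v) g∣d+v) g∣v)

∣spaced∣ : ∀ {g m} .{{_ : NonZero g}} → m * g < n → ∣ ⟦_⟧ {n} (spaced? g m) ∣ ≡ suc m
∣spaced∣ {suc b} {g} {zero} _ = trans (cong ∣_∣ (⟦⟧-cong (spaced? g 0) (_≟ 0) Spaced0⇔≡0)) (∣⟦≡0⟧∣ b)
  where
  Spaced0⇔≡0 : ∀ v → v < suc b → Spaced g 0 v ⇔ v ≡ 0
  Spaced0⇔≡0 v _ = mk⇔ (n≤0⇒n≡0 ∘ proj₂) λ { refl → g ∣0 , z≤n }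
∣spaced∣ {n} {g@(suc h)} {suc m} [1+m]g<n = begin
  ∣ ⟦_⟧ {n} P? ∣                           ≡⟨ cong (λ n → ∣ ⟦_⟧ {n} P? ∣) (m+[n∸m]≡n g≤n) ⟨
  ∣ ⟦_⟧ {g + r} P? ∣                       ≡⟨ ∣⟦⟧∣-+ P? g r ⟩
  ∣ ⟦_⟧ {g} P? ∣ + ∣ ⟦_⟧ {r} shifted ∣      ≡⟨ cong₂ _+_ first-block rest ⟩
  1 + suc m                                ∎
  where
  open ≡-Reasoning
  P? = spaced? g (suc m)
  r = n ∸ g
  shifted = λ v → P? (g + v)
  g≤n : g ≤ n
  g≤n = ≤-trans (m≤m+n g (suc (m * g))) (≤-trans (≤-reflexive (+-suc g (m * g))) [1+m]g<n)
  first-block : ∣ ⟦_⟧ {g} P? ∣ ≡ 1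
  first-block = trans (cong ∣_∣ (⟦⟧-cong P? (_≟ 0) only0)) (∣⟦≡0⟧∣ h)
    where
    only0 : ∀ v → v < g → Spaced g (suc m) v ⇔ v ≡ 0
    only0 zero    _   = mk⇔ (λ _ → refl) (λ _ → g ∣0 , z≤n)
    only0 (suc v) v<g = mk⇔ (λ (g∣v , _) → contradiction (∣⇒≤ g∣v) (<⇒≱ v<g)) λ ()
  rest : ∣ ⟦_⟧ {r} shifted ∣ ≡ suc m
  rest = trans (cong ∣_∣ (⟦⟧-cong shifted (spaced? g m) unshift)) (∣spaced∣ mg<r)
    where
    unshift : ∀ v → v < r → Spaced g (suc m) (g + v) ⇔ Spaced g m v
    unshift v _ = mk⇔
      (λ (g∣g+v , g+v≤g+mg) → ∣m+n∣m⇒∣n g∣g+v (n∣n {g}) , +-cancelˡ-≤ g v (m * g) g+v≤g+mg)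
      (λ (g∣v , v≤mg) → ∣m∣n⇒∣m+n (n∣n {g}) g∣v , +-monoʳ-≤ g v≤mg)
    mg<r : m * g < r
    mg<r = m+n≤o⇒m≤o∸n (suc (m * g)) (≤-trans (≤-reflexive (cong suc (+-comm (m * g) g))) [1+m]g<n)

-- Complements of graphs

closedAdj : Graph n → Fin n → Fin n → Bool
closedAdj G x j = ⌊ toℕ x ≟ toℕ j ⌋ ∨ G x j

closedN : Graph n → Fin n → Subset n
closedN G x = tabulate (closedAdj G x)

closedAdj-sym : {G : Graph n} → (∀ x y → G x y ≡ G y x) → ∀ x y → closedAdj G x y ≡ closedAdj G y x
closedAdj-sym G-sym x y = cong₂ _∨_ (⌊≟⌋-sym (toℕ x) (toℕ y)) (G-sym x y)
  where
  ⌊≟⌋-sym : ∀ a b → ⌊ a ≟ b ⌋ ≡ ⌊ b ≟ a ⌋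
  ⌊≟⌋-sym a b with a ≟ b | b ≟ a
  ... | yes _   | yes _   = refl
  ... | no  _   | no  _   = refl
  ... | yes a≡b | no  b≢a = contradiction (sym a≡b) b≢a
  ... | no  a≢b | yes b≡a = contradiction (sym b≡a) a≢b

∈closedN⇔ : {G : Graph n} {x j : Fin n} → j ∈ closedN G x ⇔ (x ≡ j ⊎ T (G x j))
∈closedN⇔ = mk⇔
  (Sum.map (toℕ-injective ∘ toWitness) id ∘ Equivalence.to T-∨ ∘ Equivalence.to ∈-tabulate⇔)
  (Equivalence.from ∈-tabulate⇔ ∘ Equivalence.from T-∨ ∘ Sum.map (fromWitness ∘ cong toℕ) id)

x∈closedN : (G : Graph n) (x : Fin n) → x ∈ closedN G x
x∈closedN G x = Equivalence.from (∈closedN⇔ {G = G}) (inj₁ refl)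

N-complement : (G : Graph n) (x : Fin n) → N (complement G) x ≡ ∁ (closedN G x)
N-complement G x = trans (tabulate-cong λ j → not-∨ ⌊ toℕ x ≟ toℕ j ⌋ (G x j)) (tabulate-∘ not _)
  where
  not-∨ : ∀ a b → not a ∧ not b ≡ not (a ∨ b)
  not-∨ true  b = refl
  not-∨ false b = refl

complement-dominates⇔ : (G : Graph n) (x : Fin n) (S : Subset n) →
  k ≤ ∣ N (complement G) x ∩ S ∣ ⇔ k + ∣ closedN G x ∩ S ∣ ≤ ∣ S ∣
complement-dominates⇔ {k = k} G x S = mk⇔
  (λ k≤r → subst (k + c ≤_) split (≤-trans (+-monoˡ-≤ c k≤r) (≤-reflexive (+-comm _ c))))
  (λ k+c≤S → +-cancelʳ-≤ c k _ (≤-trans k+c≤S (≤-reflexive (trans (sym split) (+-comm c _)))))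
  where
  C = closedN G x
  c = ∣ C ∩ S ∣
  split : c + ∣ N (complement G) x ∩ S ∣ ≡ ∣ S ∣
  split = begin
    ∣ C ∩ S ∣ + ∣ N (complement G) x ∩ S ∣ ≡⟨ cong (λ p → ∣ C ∩ S ∣ + ∣ p ∩ S ∣) (N-complement G x) ⟩
    ∣ C ∩ S ∣ + ∣ ∁ C ∩ S ∣
      ≡⟨ cong₂ (λ p q → ∣ p ∣ + ∣ q ∣) (∩-comm C S) (∩-comm (∁ C) S) ⟩
    ∣ S ∩ C ∣ + ∣ S ∩ ∁ C ∣               ≡⟨ ∣p∩q∣+∣p∩∁q∣≡∣p∣ S C ⟩
    ∣ S ∣                                 ∎
    where open ≡-Reasoning

IsKTRDSᶜ : ℕ → Graph n → Subset n → Set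
IsKTRDSᶜ {n} k G S =
  (∀ x → k + ∣ closedN G x ∩ S ∣ ≤ ∣ S ∣) ×
  (∀ x → lookup S x ≡ false → k + ∣ closedN G x ∩ ∁ S ∣ ≤ ∣ ∁ S ∣)

IsKTRDS-complement⇔ : (G : Graph n) (S : Subset n) → IsKTRDS k (complement G) S ⇔ IsKTRDSᶜ k G S
IsKTRDS-complement⇔ G S = mk⇔
  (λ (dom , res) → (λ x → to (dom x)) , (λ x x∉S → to (res x x∉S)))
  (λ (dom , res) → (λ x → from (dom x)) , (λ x x∉S → from (res x x∉S)))
  where
  to = λ {x} {T} → Equivalence.to (complement-dominates⇔ G x T)
  from = λ {x} {T} → Equivalence.from (complement-dominates⇔ G x T)

k+1≤∣S∣ : {G : Graph n} {S : Subset n} → 1 ≤ k → Fin n → IsKTRDSᶜ k G S → k + 1 ≤ ∣ S ∣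
k+1≤∣S∣ {n} {k} {G} {S} 1≤k x (dom , _) with nonempty? S
... | yes (y , y∈S) = ≤-trans (+-monoʳ-≤ k y∈Cy∩S) (dom y)
  where
  y∈Cy∩S : 1 ≤ ∣ closedN G y ∩ S ∣
  y∈Cy∩S = length≤∣p∣ ([] ∷ []) (x∈p∩q⁺ (x∈closedN G y , y∈S) ∷ [])
... | no S-empty = contradiction (≤-trans 1≤k (≤-trans (m≤m+n k _) (dom x))) ∣S∣≢0
  where
  ∣S∣≢0 : ¬ 1 ≤ ∣ S ∣
  ∣S∣≢0 1≤∣S∣ = case trans (cong ∣_∣ (Empty-unique S-empty)) (∣⊥∣≡0 n) of λ ∣S∣≡0 →
    contradiction (subst (1 ≤_) ∣S∣≡0 1≤∣S∣) λ ()

2k+∣C∣≤n : {G : Graph n} {S : Subset n} → IsKTRDSᶜ k G S →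
  ∀ x → lookup S x ≡ false → 2 * k + ∣ closedN G x ∣ ≤ n
2k+∣C∣≤n {n} {k} {G} {S} (dom , res) x x∉S = begin
  2 * k + ∣ C ∣                           ≡⟨ cong (2 * k +_) (∣p∩q∣+∣p∩∁q∣≡∣p∣ C S) ⟨
  2 * k + (∣ C ∩ S ∣ + ∣ C ∩ ∁ S ∣)       ≡⟨ regroup k ∣ C ∩ S ∣ ∣ C ∩ ∁ S ∣ ⟩
  (k + ∣ C ∩ S ∣) + (k + ∣ C ∩ ∁ S ∣)     ≤⟨ +-mono-≤ (dom x) (res x x∉S) ⟩
  ∣ S ∣ + ∣ ∁ S ∣                          ≡⟨ ∣p∣+∣∁p∣≡n S ⟩
  n                                        ∎
  where
  open ≤-Reasoning
  C = closedN G x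
  regroup : ∀ k a b → 2 * k + (a + b) ≡ (k + a) + (k + b)
  regroup = solve-∀

n≤∣S∣ : {G : Graph n} {S : Subset n} → (∀ x → 3 ≤ ∣ closedN G x ∣) → n ≤ 2 * k + 2 →
  IsKTRDSᶜ k G S → n ≤ ∣ S ∣
n≤∣S∣ {n} {k} {S = S} 3≤∣C∣ n≤2k+2 S-ok =
  ≤-trans (≤-reflexive (sym (∣⊤∣≡n n))) (p⊆q⇒∣p∣≤∣q∣ ⊤⊆S)
  where
  ⊤⊆S : ⊤ ⊆ S
  ⊤⊆S {x} _ with lookup S x in eq
  ... | true  = lookup⇒[]= x S eq
  ... | false = contradiction (+-cancelˡ-≤ (2 * k) 3 2 2k+3≤2k+2) λ { (s≤s (s≤s ())) }
    where
    2k+3≤2k+2 : 2 * k + 3 ≤ 2 * k + 2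
    2k+3≤2k+2 = ≤-trans (+-monoʳ-≤ (2 * k) (3≤∣C∣ x)) (≤-trans (2k+∣C∣≤n S-ok x eq) n≤2k+2)

k+2≤∣S∣ : {G : Graph n} {S : Subset n} → (∀ x y → G x y ≡ G y x) → (∀ x → 3 ≤ ∣ closedN G x ∣) →
  1 ≤ k → Fin n → n ≤ 3 * k + 2 → IsKTRDSᶜ k G S → k + 2 ≤ ∣ S ∣
k+2≤∣S∣ {n} {k} {G} {S} G-sym 3≤∣C∣ 1≤k x n≤3k+2 S-ok@(dom , _)
  with m≤n⇒m<n∨m≡n (k+1≤∣S∣ 1≤k x S-ok)
... | inj₁ k+1<∣S∣ = ≤-trans (≤-reflexive (+-suc k 1)) k+1<∣S∣
... | inj₂ k+1≡∣S∣ =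
  contradiction (≤-trans 3[k+1]≤n n≤3k+2) (<⇒≱ (≤-reflexive (sym (3[k+1]≡1+[3k+2] k))))
  where
  ∣C∩S∣≤1 : ∀ x → ∣ closedN G x ∩ S ∣ ≤ 1
  ∣C∩S∣≤1 x = +-cancelˡ-≤ k _ 1 (≤-trans (dom x) (≤-reflexive (sym k+1≡∣S∣)))
  3[k+1]≤n : 3 * (k + 1) ≤ n
  3[k+1]≤n = begin
    3 * (k + 1) ≡⟨ cong (3 *_) k+1≡∣S∣ ⟩
    3 * ∣ S ∣   ≤⟨ double-counting (closedAdj-sym G-sym) 3≤∣C∣ ∣C∩S∣≤1 ⟩
    n * 1       ≡⟨ *-identityʳ n ⟩
    n           ∎
    where open ≤-Reasoning
  3[k+1]≡1+[3k+2] : ∀ k → 3 * (k + 1) ≡ suc (3 * k + 2)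
  3[k+1]≡1+[3k+2] = solve-∀

-- The cycle

next : Fin n → Fin n
next {suc m} i with m ≟ toℕ i
... | yes _   = fzero
... | no m≢i = fsuc (lower₁ i m≢i)

prev : Fin n → Fin n
prev {suc m} fzero    = fromℕ m
prev {suc m} (fsuc i) = inject₁ i

data Window (n : ℕ) : ℕ → ℕ → ℕ → Set where
  first    : ∀ {p} → suc p ≡ n → Window n p 0 1
  interior : ∀ b → Window n b (suc b) (suc (suc b))
  last     : ∀ {b} → suc (suc b) ≡ n → Window n b (suc b) 0

window : 2 ≤ n → (x : Fin n) → Window n (toℕ (prev x)) (toℕ x) (toℕ (next x))
window {suc m} 2≤n fzero with m ≟ 0
... | yes refl = contradiction 2≤n λ { (s≤s ()) }
... | no m≢0 rewrite toℕ-lower₁ fzero m≢0 | toℕ-fromℕ m = first refl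
window {suc m} 2≤n (fsuc i) with m ≟ suc (toℕ i)
... | yes m≡1+i rewrite toℕ-inject₁ i = last (cong suc (sym m≡1+i))
... | no m≢1+i rewrite toℕ-inject₁ i | toℕ-lower₁ (fsuc i) m≢1+i = interior (toℕ i)

CycleAdj : ℕ → ℕ → ℕ → Set
CycleAdj n a b = b ≡ suc a ⊎ a ≡ suc b ⊎ (a ≡ 0 × suc b ≡ n) ⊎ (b ≡ 0 × suc a ≡ n)

T-cycleAdj⇔ : {x y : Fin n} → T (cycleAdj n x y) ⇔ CycleAdj n (toℕ x) (toℕ y)
T-cycleAdj⇔ {n} {x} {y} =
  (⌊⌋⇔ (b ≟ suc a) ⊎-⇔
    (⌊⌋⇔ (a ≟ suc b) ⊎-⇔
      (T∧⇔ (a ≟ 0) (suc b ≟ n) ⊎-⇔ T∧⇔ (b ≟ 0) (suc a ≟ n)) ⇔-∘ T-∨) ⇔-∘ T-∨) ⇔-∘ T-∨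
  where
  a = toℕ x
  b = toℕ y
  ⌊⌋⇔ : {A : Set} (a? : Dec A) → T ⌊ a? ⌋ ⇔ A
  ⌊⌋⇔ _ = mk⇔ toWitness fromWitness
  T∧⇔ : {A B : Set} (a? : Dec A) (b? : Dec B) → T (⌊ a? ⌋ ∧ ⌊ b? ⌋) ⇔ (A × B)
  T∧⇔ a? b? = (⌊⌋⇔ a? ×-⇔ ⌊⌋⇔ b?) ⇔-∘ T-∧

cycleAdj-sym : (x y : Fin n) → cycleAdj n x y ≡ cycleAdj n y x
cycleAdj-sym {n} x y =
  ∨-swap ⌊ toℕ y ≟ suc (toℕ x) ⌋ ⌊ toℕ x ≟ suc (toℕ y) ⌋
         (⌊ toℕ x ≟ 0 ⌋ ∧ ⌊ suc (toℕ y) ≟ n ⌋) (⌊ toℕ y ≟ 0 ⌋ ∧ ⌊ suc (toℕ x) ≟ n ⌋)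
  where
  ∨-swap : ∀ a b c d → a ∨ b ∨ c ∨ d ≡ b ∨ a ∨ d ∨ c
  ∨-swap true  true  c d = refl
  ∨-swap true  false c d = refl
  ∨-swap false true  c d = refl
  ∨-swap false false c d = ∨-comm c d

window-adj⇔ : ∀ {p a s b} → Window n p a s → b < n → s < n → CycleAdj n a b ⇔ (b ≡ s ⊎ b ≡ p)
window-adj⇔ {n} (first {p} 1+p≡n) _ 1<n = mk⇔ to from
  where
  to : ∀ {b} → CycleAdj n 0 b → b ≡ 1 ⊎ b ≡ p
  to (inj₁ refl)                          = inj₁ refl
  to (inj₂ (inj₂ (inj₁ (_ , 1+b≡n))))     = inj₂ (suc-injective (trans 1+b≡n (sym 1+p≡n)))
  to (inj₂ (inj₂ (inj₂ (_ , 1≡n))))       = contradiction 1<n (<-irrefl 1≡n)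
  from : ∀ {b} → b ≡ 1 ⊎ b ≡ p → CycleAdj n 0 b
  from (inj₁ refl) = inj₁ refl
  from (inj₂ refl) = inj₂ (inj₂ (inj₁ (refl , 1+p≡n)))
window-adj⇔ {n} (interior b) _ s<n = mk⇔ to from
  where
  to : ∀ {c} → CycleAdj n (suc b) c → c ≡ suc (suc b) ⊎ c ≡ b
  to (inj₁ refl)                      = inj₁ refl
  to (inj₂ (inj₁ 1+b≡1+c))            = inj₂ (sym (suc-injective 1+b≡1+c))
  to (inj₂ (inj₂ (inj₂ (_ , 2+b≡n)))) = contradiction s<n (<-irrefl 2+b≡n)
  from : ∀ {c} → c ≡ suc (suc b) ⊎ c ≡ b → CycleAdj n (suc b) c
  from (inj₁ refl) = inj₁ refl
  from (inj₂ refl) = inj₂ (inj₁ refl)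
window-adj⇔ {n} {b = c} (last {b} 2+b≡n) c<n _ = mk⇔ to from
  where
  to : CycleAdj n (suc b) c → c ≡ 0 ⊎ c ≡ b
  to (inj₁ refl)                    = contradiction c<n (<-irrefl 2+b≡n)
  to (inj₂ (inj₁ 1+b≡1+c))          = inj₂ (sym (suc-injective 1+b≡1+c))
  to (inj₂ (inj₂ (inj₂ (c≡0 , _)))) = inj₁ c≡0
  from : c ≡ 0 ⊎ c ≡ b → CycleAdj n (suc b) c
  from (inj₁ refl) = inj₂ (inj₂ (inj₂ (refl , 2+b≡n)))
  from (inj₂ refl) = inj₂ (inj₁ refl)

∈closedN-cycle⇔ : 2 ≤ n → {x j : Fin n} →
  j ∈ closedN (cycleAdj n) x ⇔ (j ≡ x ⊎ j ≡ next x ⊎ j ≡ prev x)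
∈closedN-cycle⇔ 2≤n {x} {j} =
  (mk⇔ sym sym ⊎-⇔
    ((toℕ≡⇔ ⊎-⇔ toℕ≡⇔) ⇔-∘ (window-adj⇔ (window 2≤n x) (toℕ<n j) (toℕ<n (next x)) ⇔-∘ T-cycleAdj⇔)))
  ⇔-∘ ∈closedN⇔ {G = cycleAdj _}
  where
  toℕ≡⇔ : {i j : Fin _} → toℕ i ≡ toℕ j ⇔ i ≡ j
  toℕ≡⇔ = mk⇔ toℕ-injective (cong toℕ)

window-distinct : 3 ≤ n → ∀ {p a s} → Window n p a s → s ≢ a × p ≢ a × s ≢ p
window-distinct {n} 3≤n (first 1+p≡n) =
  (λ ()) , (λ { refl → n≢1 (sym 1+p≡n) }) , (λ { refl → n≢2 (sym 1+p≡n) })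
  where
  n≢1 : n ≢ 1
  n≢1 refl = contradiction 3≤n λ { (s≤s ()) }
  n≢2 : n ≢ 2
  n≢2 refl = contradiction 3≤n λ { (s≤s (s≤s ())) }
window-distinct 3≤n (interior b) =
  ≢-sym (<⇒≢ (n<1+n (suc b))) , <⇒≢ (n<1+n b) , ≢-sym (<⇒≢ (m<n⇒m<1+n (n<1+n b)))
window-distinct {n} 3≤n (last {b} 2+b≡n) = (λ ()) , <⇒≢ (n<1+n b) , λ { refl → n≢2 (sym 2+b≡n) }
  where
  n≢2 : n ≢ 2
  n≢2 refl = contradiction 3≤n λ { (s≤s (s≤s ())) }

AtMostOneOf : Pred ℕ 0ℓ → ℕ → ℕ → ℕ → Set
AtMostOneOf P p a s = (¬ P p × ¬ P a) ⊎ (¬ P p × ¬ P s) ⊎ (¬ P a × ¬ P s)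

NotAllOf : Pred ℕ 0ℓ → ℕ → ℕ → ℕ → Set
NotAllOf P p a s = ¬ P p ⊎ ¬ P a ⊎ ¬ P s

module _ {n} (3≤n : 3 ≤ n) (x : Fin n) where

  private
    2≤n = ≤-trans (n≤1+n 2) 3≤n
    C = closedN (cycleAdj n) x
    p̂ = toℕ (prev x)
    â = toℕ x
    ŝ = toℕ (next x)

    self∈C : x ∈ C
    self∈C = x∈closedN (cycleAdj n) x

    next∈C : next x ∈ C
    next∈C = Equivalence.from (∈closedN-cycle⇔ 2≤n {x}) (inj₂ (inj₁ refl))

    prev∈C : prev x ∈ C
    prev∈C = Equivalence.from (∈closedN-cycle⇔ 2≤n {x}) (inj₂ (inj₂ refl))

    distinct = window-distinct 3≤n (window 2≤n x)

    x≢next : x ≢ next x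
    x≢next = ≢-sym (proj₁ distinct ∘ cong toℕ)

    x≢prev : x ≢ prev x
    x≢prev = ≢-sym (proj₁ (proj₂ distinct) ∘ cong toℕ)

    next≢prev : next x ≢ prev x
    next≢prev = proj₂ (proj₂ distinct) ∘ cong toℕ

  3≤∣closedN-cycle∣ : 3 ≤ ∣ C ∣
  3≤∣closedN-cycle∣ = length≤∣p∣ {xs = x ∷ next x ∷ prev x ∷ []}
    ((x≢next ∷ x≢prev ∷ []) ∷ (next≢prev ∷ []) ∷ [] ∷ [])
    (self∈C ∷ next∈C ∷ prev∈C ∷ [])

  ∣C∩T∣+length≤3 : (T : Subset n) {ys : List (Fin n)} → Unique ys → All (_∈ C ∩ ∁ T) ys →
    ∣ C ∩ T ∣ + length ys ≤ 3
  ∣C∩T∣+length≤3 T {ys} ys-unique ys⊆C-T = begin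
    ∣ C ∩ T ∣ + length ys     ≤⟨ +-monoʳ-≤ ∣ C ∩ T ∣ (length≤∣p∣ ys-unique ys⊆C-T) ⟩
    ∣ C ∩ T ∣ + ∣ C ∩ ∁ T ∣   ≡⟨ ∣p∩q∣+∣p∩∁q∣≡∣p∣ C T ⟩
    ∣ C ∣                    ≤⟨ ∣p∣≤length (x ∷ next x ∷ prev x ∷ []) C⊆ ⟩
    3                        ∎
    where
    open ≤-Reasoning
    C⊆ : ∀ {j} → j ∈ C → j ∈ₗ x ∷ next x ∷ prev x ∷ []
    C⊆ j∈C with Equivalence.to (∈closedN-cycle⇔ 2≤n {x}) j∈C
    ... | inj₁ refl        = here refl
    ... | inj₂ (inj₁ refl) = there (here refl)
    ... | inj₂ (inj₂ refl) = there (there (here refl))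

  ∣C∩T∣≤3 : (T : Subset n) → ∣ C ∩ T ∣ ≤ 3
  ∣C∩T∣≤3 T = ≤-trans (≤-reflexive (sym (+-identityʳ _))) (∣C∩T∣+length≤3 T [] [])

  module _ {P : Pred ℕ 0ℓ} (P? : Decidable P) where

    private
      outside : ∀ {y} → y ∈ C → ¬ P (toℕ y) → y ∈ C ∩ ∁ ⟦ P? ⟧
      outside y∈C ¬Py = x∈p∩q⁺ (y∈C , x∉p⇒x∈∁p (¬Py ∘ Equivalence.to (∈⟦⟧⇔ {P? = P?})))

      inside : ∀ {y} → y ∈ C → P (toℕ y) → y ∈ C ∩ ∁ (∁ ⟦ P? ⟧)
      inside y∈C Py = x∈p∩q⁺ (y∈C , x∉p⇒x∈∁p (x∈p⇒x∉∁p (Equivalence.from (∈⟦⟧⇔ {P? = P?}) Py)))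

      two-outside : ∀ {y z} → y ≢ z → y ∈ C ∩ ∁ ⟦ P? ⟧ → z ∈ C ∩ ∁ ⟦ P? ⟧ → ∣ C ∩ ⟦ P? ⟧ ∣ ≤ 1
      two-outside y≢z y∈ z∈ =
        +-cancelʳ-≤ 2 _ 1 (∣C∩T∣+length≤3 ⟦ P? ⟧ ((y≢z ∷ []) ∷ [] ∷ []) (y∈ ∷ z∈ ∷ []))

      one-outside : ∀ {y} → y ∈ C ∩ ∁ ⟦ P? ⟧ → ∣ C ∩ ⟦ P? ⟧ ∣ ≤ 2
      one-outside y∈ = +-cancelʳ-≤ 1 _ 2 (∣C∩T∣+length≤3 ⟦ P? ⟧ ([] ∷ []) (y∈ ∷ []))

    ∣C∩⟦P⟧∣≤1 : AtMostOneOf P p̂ â ŝ → ∣ C ∩ ⟦ P? ⟧ ∣ ≤ 1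
    ∣C∩⟦P⟧∣≤1 (inj₁ (¬Pp , ¬Pa)) =
      two-outside (≢-sym x≢prev) (outside prev∈C ¬Pp) (outside self∈C ¬Pa)
    ∣C∩⟦P⟧∣≤1 (inj₂ (inj₁ (¬Pp , ¬Ps))) =
      two-outside (≢-sym next≢prev) (outside prev∈C ¬Pp) (outside next∈C ¬Ps)
    ∣C∩⟦P⟧∣≤1 (inj₂ (inj₂ (¬Pa , ¬Ps))) =
      two-outside x≢next (outside self∈C ¬Pa) (outside next∈C ¬Ps)

    ∣C∩⟦P⟧∣≤2 : NotAllOf P p̂ â ŝ → ∣ C ∩ ⟦ P? ⟧ ∣ ≤ 2
    ∣C∩⟦P⟧∣≤2 (inj₁ ¬Pp)        = one-outside (outside prev∈C ¬Pp)
    ∣C∩⟦P⟧∣≤2 (inj₂ (inj₁ ¬Pa)) = one-outside (outside self∈C ¬Pa)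
    ∣C∩⟦P⟧∣≤2 (inj₂ (inj₂ ¬Ps)) = one-outside (outside next∈C ¬Ps)

    ∣C∩∁⟦P⟧∣≤1 : P p̂ → P ŝ → ∣ C ∩ ∁ ⟦ P? ⟧ ∣ ≤ 1
    ∣C∩∁⟦P⟧∣≤1 Pp Ps = +-cancelʳ-≤ 2 _ 1
      (∣C∩T∣+length≤3 (∁ ⟦ P? ⟧) ((next≢prev ∷ []) ∷ [] ∷ []) (inside next∈C Ps ∷ inside prev∈C Pp ∷ []))

¬Spaced-beyond : ∀ {g m v} → m * g < v → ¬ Spaced g m v
¬Spaced-beyond mg<v (_ , v≤mg) = <⇒≱ mg<v v≤mg

¬Spaced-near : ∀ {g m v} d → suc d < g → g ∣ v → ¬ Spaced g m (suc d + v)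
¬Spaced-near d d<g g∣v (g∣d+v , _) = <⇒≱ d<g (multiples-apart d g∣v g∣d+v)

parity : ∀ v → (2 ∣ v) ⊎ (2 ∣ suc v)
parity zero    = inj₁ (2 ∣0)
parity (suc v) = Sum.swap (Sum.map₁ (∣m∣n⇒∣m+n (n∣n {2})) (parity v))

2∤1+v⇒2∣v : ∀ v → ¬ 2 ∣ suc v → 2 ∣ v
2∤1+v⇒2∣v v 2∤1+v = Sum.[ id , flip contradiction 2∤1+v ]′ (parity v)

even≤odd⇒< : ∀ {v m} → 2 ∣ v → v ≤ suc (m * 2) → v ≤ m * 2
even≤odd⇒< {v} {m} 2∣v v≤1+2m with m≤n⇒m<n∨m≡n v≤1+2m
... | inj₁ v<1+2m = s≤s⁻¹ v<1+2m
... | inj₂ refl   = contradiction (multiples-apart 0 (n∣m*n m) 2∣v) λ { (s≤s ()) }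

spaced-window-3 : ∀ {k p a s} → 3 + k * 3 ≤ n → Window n p a s → AtMostOneOf (Spaced 3 k) p a s
spaced-window-3 {n} {k} 3+3k≤n (first 1+p≡n) =
  inj₂ (inj₁ (¬Spaced-beyond {m = k} 3k<p , >⇒∤ (s≤s (s≤s z≤n)) ∘ proj₁))
  where
  3k<p = ≤-trans (n≤1+n _) (s≤s⁻¹ (subst (3 + k * 3 ≤_) (sym 1+p≡n) 3+3k≤n))
spaced-window-3 {k = k} _ (interior b) with spaced? 3 k b | spaced? 3 k (suc b)
... | yes (3∣b , _) | _              = inj₂ (inj₂ (¬Spaced-near {m = k} 0 (s≤s (s≤s z≤n)) 3∣b ,
                                                   ¬Spaced-near {m = k} 1 ≤-refl 3∣b))
... | no ¬b         | yes (3∣1+b , _) = inj₂ (inj₁ (¬b , ¬Spaced-near {m = k} 0 (s≤s (s≤s z≤n)) 3∣1+b))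
... | no ¬b         | no ¬1+b         = inj₁ (¬b , ¬1+b)
spaced-window-3 {n} {k} 3+3k≤n (last 2+b≡n) =
  inj₁ (¬Spaced-beyond {m = k} 3k<b , ¬Spaced-beyond {m = k} (m<n⇒m<1+n 3k<b))
  where
  3k<b = s≤s⁻¹ (s≤s⁻¹ (subst (3 + k * 3 ≤_) (sym 2+b≡n) 3+3k≤n))

spaced-consecutive : ∀ m b → ¬ Spaced 2 m b ⊎ ¬ Spaced 2 m (suc b)
spaced-consecutive m b with 2 ∣? b
... | yes 2∣b = inj₂ (¬Spaced-near {m = m} 0 ≤-refl 2∣b)
... | no  2∤b = inj₁ (2∤b ∘ proj₁)

spaced-window-2 : ∀ {m p a s} → Window n p a s → NotAllOf (Spaced 2 m) p a s
spaced-window-2         (first _)    = inj₂ (inj₂ (>⇒∤ (s≤s (s≤s z≤n)) ∘ proj₁))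
spaced-window-2 {m = m} (interior b) = Sum.map₂ inj₁ (spaced-consecutive m b)
spaced-window-2 {m = m} (last {b} _) = Sum.map₂ inj₁ (spaced-consecutive m b)

spaced-window-2ᶜ : ∀ {m p a s} → Window n p a s → s < n → n ≤ 2 + m * 2 →
  ¬ Spaced 2 m a → Spaced 2 m p × Spaced 2 m s
spaced-window-2ᶜ (first _) _ _ ¬0 = contradiction (2 ∣0 , z≤n) ¬0
spaced-window-2ᶜ {n} {m} (interior b) 2+b<n n≤2+2m ¬1+b =
  (2∣b , ≤-trans (n≤1+n b) 1+b≤2m) , (2∣2+b , even≤odd⇒< {m = m} 2∣2+b (s≤s 1+b≤2m))
  where
  1+b≤2m : suc b ≤ m * 2
  1+b≤2m = s≤s⁻¹ (s≤s⁻¹ (≤-trans 2+b<n n≤2+2m))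
  2∣b = 2∤1+v⇒2∣v b λ 2∣1+b → ¬1+b (2∣1+b , 1+b≤2m)
  2∣2+b = ∣m∣n⇒∣m+n (n∣n {2}) 2∣b
spaced-window-2ᶜ {n} {m} (last {b} 2+b≡n) _ n≤2+2m ¬1+b = (2∣b , s≤s⁻¹ 1+b≤1+2m) , (2 ∣0 , z≤n)
  where
  1+b≤1+2m : suc b ≤ suc (m * 2)
  1+b≤1+2m = s≤s⁻¹ (subst (_≤ 2 + m * 2) (sym 2+b≡n) n≤2+2m)
  2∣b = 2∤1+v⇒2∣v b λ 2∣1+b → ¬1+b (2∣1+b , even≤odd⇒< {m = m} 2∣1+b 1+b≤1+2m)

-- Optimal sets

IsKTRDSᶜ-intro : {G : Graph n} (S : Subset n) {s c c′ : ℕ} → ∣ S ∣ ≡ s →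
  (∀ x → ∣ closedN G x ∩ S ∣ ≤ c) → k + c ≤ s →
  (∀ x → lookup S x ≡ false → ∣ closedN G x ∩ ∁ S ∣ ≤ c′) → (k + c′) + s ≤ n →
  IsKTRDSᶜ k G S
IsKTRDSᶜ-intro {n} {k} S {s} {c} {c′} ∣S∣≡s C∩S≤c k+c≤s C∩∁S≤c′ k+c′+s≤n =
  (λ x → ≤-trans (+-monoʳ-≤ k (C∩S≤c x)) (≤-trans k+c≤s (≤-reflexive (sym ∣S∣≡s)))) ,
  (λ x x∉S → ≤-trans (+-monoʳ-≤ k (C∩∁S≤c′ x x∉S)) k+c′≤∣∁S∣)
  where
  k+c′≤∣∁S∣ : k + c′ ≤ ∣ ∁ S ∣
  k+c′≤∣∁S∣ = +-cancelʳ-≤ ∣ S ∣ _ _ (begin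
    (k + c′) + ∣ S ∣  ≡⟨ cong (k + c′ +_) ∣S∣≡s ⟩
    (k + c′) + s      ≤⟨ k+c′+s≤n ⟩
    n                 ≡⟨ ∣p∣+∣∁p∣≡n S ⟨
    ∣ S ∣ + ∣ ∁ S ∣   ≡⟨ +-comm ∣ S ∣ _ ⟩
    ∣ ∁ S ∣ + ∣ S ∣   ∎)
    where open ≤-Reasoning

IsKTRDNumber-complement : {G : Graph n} {m : ℕ} (S : Subset n) → IsKTRDSᶜ k G S → ∣ S ∣ ≡ m →
  (∀ S → IsKTRDSᶜ k G S → m ≤ ∣ S ∣) → IsKTRDNumber k (complement G) m
IsKTRDNumber-complement {G = G} S S-ok ∣S∣≡m minimal =
  (S , Equivalence.from (IsKTRDS-complement⇔ G S) S-ok , ∣S∣≡m) ,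
  λ T T-ok → minimal T (Equivalence.to (IsKTRDS-complement⇔ G T) T-ok)

γ≡n : k + 3 ≤ n → n ≤ 2 * k + 2 → IsKTRDNumber k (coCycle n) n
γ≡n {k} {n} k+3≤n n≤2k+2 =
  IsKTRDNumber-complement ⊤ ⊤-ok (∣⊤∣≡n n) (λ _ → n≤∣S∣ (3≤∣closedN-cycle∣ 3≤n) n≤2k+2)
  where
  3≤n = ≤-trans (m≤n+m 3 k) k+3≤n
  ⊤-ok : IsKTRDSᶜ k (cycleAdj n) ⊤
  ⊤-ok = (λ x → ≤-trans (+-monoʳ-≤ k (∣C∩T∣≤3 3≤n x ⊤)) (≤-trans k+3≤n (≤-reflexive (sym (∣⊤∣≡n n))))) ,
         (λ x x∉⊤ → contradiction (trans (sym (lookup-replicate x true)) x∉⊤) λ ())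

γ≡k+2 : 1 ≤ k → 2 * k + 3 ≤ n → n ≤ 3 * k + 2 → IsKTRDNumber k (coCycle n) (k + 2)
γ≡k+2 {k} {n} 1≤k 2k+3≤n n≤3k+2 =
  IsKTRDNumber-complement S S-ok ∣S∣≡k+2
    (λ _ → k+2≤∣S∣ cycleAdj-sym (3≤∣closedN-cycle∣ 3≤n) 1≤k (fromℕ< 0<n) n≤3k+2)
  where
  2k+3≡1+[k+1]2 : ∀ k → 2 * k + 3 ≡ suc (suc k * 2)
  2k+3≡1+[k+1]2 = solve-∀
  2k+3≡[k+1]+[k+2] : ∀ k → 2 * k + 3 ≡ (k + 1) + (k + 2)
  2k+3≡[k+1]+[k+2] = solve-∀
  3+[k+1]2≡[k+3]+[k+2] : ∀ k → suc (2 + suc k * 2) ≡ (k + 3) + (k + 2)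
  3+[k+1]2≡[k+3]+[k+2] = solve-∀
  S = ⟦ spaced? 2 (suc k) ⟧
  3≤n = ≤-trans (s≤s (s≤s (s≤s z≤n))) (≤-trans (m≤n+m 3 (2 * k)) 2k+3≤n)
  2≤n = ≤-trans (n≤1+n 2) 3≤n
  0<n = ≤-trans (s≤s z≤n) 3≤n
  ∣S∣≡k+2 : ∣ S ∣ ≡ k + 2
  ∣S∣≡k+2 = trans (∣spaced∣ (subst (_≤ n) (2k+3≡1+[k+1]2 k) 2k+3≤n)) (+-comm 2 k)
  C∩S≤2 : ∀ x → ∣ closedN (cycleAdj n) x ∩ S ∣ ≤ 2
  C∩S≤2 x = ∣C∩⟦P⟧∣≤2 3≤n x (spaced? 2 (suc k)) (spaced-window-2 {m = suc k} (window 2≤n x))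
  S-ok : IsKTRDSᶜ k (cycleAdj n) S
  S-ok with n ≤? 2 + suc k * 2
  ... | yes n≤2k+4 =
    IsKTRDSᶜ-intro S ∣S∣≡k+2 C∩S≤2 ≤-refl C∩∁S≤1 (subst (_≤ n) (2k+3≡[k+1]+[k+2] k) 2k+3≤n)
    where
    C∩∁S≤1 : ∀ x → lookup S x ≡ false → ∣ closedN (cycleAdj n) x ∩ ∁ S ∣ ≤ 1
    C∩∁S≤1 x x∉S = ∣C∩∁⟦P⟧∣≤1 3≤n x (spaced? 2 (suc k)) (proj₁ neighbours∈S) (proj₂ neighbours∈S)
      where
      neighbours∈S = spaced-window-2ᶜ {m = suc k} (window 2≤n x) (toℕ<n (next x)) n≤2k+4
                       (∉⟦⟧ {P? = spaced? 2 (suc k)} x∉S)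
  ... | no n≰2k+4 = IsKTRDSᶜ-intro S ∣S∣≡k+2 C∩S≤2 ≤-refl (λ x _ → ∣C∩T∣≤3 3≤n x (∁ S))
    (subst (_≤ n) (3+[k+1]2≡[k+3]+[k+2] k) (≰⇒> n≰2k+4))

γ≡k+1 : 1 ≤ k → 3 * k + 3 ≤ n → IsKTRDNumber k (coCycle n) (k + 1)
γ≡k+1 {k} {n} 1≤k 3k+3≤n =
  IsKTRDNumber-complement S S-ok ∣S∣≡k+1 (λ _ → k+1≤∣S∣ 1≤k (fromℕ< 0<n))
  where
  3k+3≡3+3k : ∀ k → 3 * k + 3 ≡ 3 + k * 3
  3k+3≡3+3k = solve-∀
  [k+3]+[k+1]≡[2k+3]+1 : ∀ k → (k + 3) + (k + 1) ≡ (2 * k + 3) + 1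
  [k+3]+[k+1]≡[2k+3]+1 = solve-∀
  [2k+3]+k≡3k+3 : ∀ k → (2 * k + 3) + k ≡ 3 * k + 3
  [2k+3]+k≡3k+3 = solve-∀
  S = ⟦ spaced? 3 k ⟧
  3+3k≤n : 3 + k * 3 ≤ n
  3+3k≤n = subst (_≤ n) (3k+3≡3+3k k) 3k+3≤n
  3≤n = ≤-trans (m≤m+n 3 (k * 3)) 3+3k≤n
  2≤n = ≤-trans (n≤1+n 2) 3≤n
  0<n = ≤-trans (s≤s z≤n) 3≤n
  ∣S∣≡k+1 : ∣ S ∣ ≡ k + 1
  ∣S∣≡k+1 = trans (∣spaced∣ (≤-trans (s≤s (m≤n+m (k * 3) 2)) 3+3k≤n)) (+-comm 1 k)
  S-ok : IsKTRDSᶜ k (cycleAdj n) S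
  S-ok = IsKTRDSᶜ-intro S ∣S∣≡k+1
    (λ x → ∣C∩⟦P⟧∣≤1 3≤n x (spaced? 3 k) (spaced-window-3 {k = k} 3+3k≤n (window 2≤n x))) ≤-refl
    (λ x _ → ∣C∩T∣≤3 3≤n x (∁ S))
    (begin
      (k + 3) + (k + 1)   ≡⟨ [k+3]+[k+1]≡[2k+3]+1 k ⟩
      (2 * k + 3) + 1     ≤⟨ +-monoʳ-≤ (2 * k + 3) 1≤k ⟩
      (2 * k + 3) + k     ≡⟨ [2k+3]+k≡3k+3 k ⟩
      3 * k + 3           ≤⟨ 3k+3≤n ⟩
      n                   ∎)
    where open ≤-Reasoning

proposition2p2 : (k n : ℕ) → 1 ≤ k → n ≥ k + 3 →
    (n ≤ 2 * k + 2 → IsKTRDNumber k (coCycle n) n) ×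
    (2 * k + 3 ≤ n → n ≤ 3 * k + 2 → IsKTRDNumber k (coCycle n) (k + 2)) ×
    (n ≥ 3 * k + 3 → IsKTRDNumber k (coCycle n) (k + 1))
proposition2p2 k n 1≤k k+3≤n = γ≡n k+3≤n , γ≡k+2 1≤k , γ≡k+1 1≤k
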